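{- Let $G$ be an Eulerian graph of order $n$, minimum degree $\delta$ and maximum degree $\Delta$. Then: (i) $\mathrm{av}(G)\leq \delta$; (ii) $\mathrm{av}(G)\leq \min_{v\in V(G)}\alpha(N(v))$, where $\alpha(N(v))$ is the independence number of the subgraph induced by the neighbours of $v$; (iii) if $\Delta=n-1$ then $\mathrm{av}(G)=1$; otherwise $\mathrm{av}(G)\leq \min_{v\in V(G)}\frac{S(v)-2}{\deg(v)}+1$, where $S(v)$ is the sum of the degrees of the vertices other than $v$ that are not adjacent to $v$. In particular, if $\Delta\leq n-2$ then $\mathrm{av}(G)\leq n-\Delta-1$.
   Context: All graphs are finite, simple and connected. An Eulerian circuit is a closed trail traversing every edge exactly once. For an Eulerian graph with $m$ edges and vertex $x$, two Eulerian circuits $x,v_1,\ldots,v_{m-1},x$ and $x,w_1,\ldots,w_{m-1},x$ are avoiding if for each $1\le i\le m-1$, $v_i\ne w_i$ and $v_i,w_i$ are non-adjacent; a set of Eulerian circuits is mutually avoiding if they are pairwise avoiding. The avoidance index $\mathrm{av}(G)$ of an Eulerian graph $G$ is the largest $k$ such that for every vertex $x$ there is a set of $k$ mutually avoiding Eulerian circuits starting and ending at $x$. -}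

module Defs where

open import Data.Nat using (ℕ; zero; suc; _+_; _*_; _∸_; _≤_; _<_)
open import Data.Bool using (Bool; true; false; not; _∧_)
open import Data.Fin using (Fin; zero; suc; toℕ; fromℕ; inject₁; _≟_)
open import Data.Fin.Subset using (Subset; _∈_; ∣_∣)
open import Data.List using (List; length; filterᵇ; map; allFin)
open import Data.Nat.ListAction using (sum)
open import Data.Product using (Σ; ∃; ∃-syntax; _×_; _,_)
open import Data.Sum using (_⊎_)
open import Relation.Nullary using (¬_; Dec; yes; no)
open import Relation.Nullary.Decidable using (isYes)
open import Relation.Binary.PropositionalEquality using (_≡_; _≢_)

record Graph (n : ℕ) : Set where
  field
    adj    : Fin n → Fin n → Bool
    sym    : ∀ u v → adj u v ≡ adj v u
    irrefl : ∀ v → adj v v ≡ false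
open Graph public

module _ {n : ℕ} (G : Graph n) where

  Adjacent : Fin n → Fin n → Set
  Adjacent u v = adj G u v ≡ true

  data Reach : Fin n → Fin n → Set where
    here : ∀ {u} → Reach u u
    step : ∀ {u v w} → Adjacent u v → Reach v w → Reach u w

  Connected : Set
  Connected = ∀ u v → Reach u v

  HasEdge : Set
  HasEdge = ∃[ u ] ∃[ v ] Adjacent u v

  SameEdge : Fin n → Fin n → Fin n → Fin n → Set
  SameEdge a b c d = (a ≡ c × b ≡ d) ⊎ (a ≡ d × b ≡ c)

  EulerianCircuit : Fin n → (m : ℕ) → (Fin (suc m) → Fin n) → Set
  EulerianCircuit x m w =
      (w zero ≡ x)
    × (w (fromℕ m) ≡ x)
    × (∀ (i : Fin m) → Adjacent (w (inject₁ i)) (w (suc i)))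
    × (∀ (i j : Fin m) → SameEdge (w (inject₁ i)) (w (suc i)) (w (inject₁ j)) (w (suc j)) → i ≡ j)
    × (∀ u v → Adjacent u v → ∃[ i ] SameEdge (w (inject₁ i)) (w (suc i)) u v)

  Eulerian : Set
  Eulerian = Connected × (∃[ x ] ∃[ m ] ∃[ w ] EulerianCircuit x m w)

  Avoiding : (m : ℕ) → (Fin (suc m) → Fin n) → (Fin (suc m) → Fin n) → Set
  Avoiding m v w = ∀ (i : Fin (suc m)) → 0 < toℕ i → toℕ i < m →
                   (v i ≢ w i) × ¬ Adjacent (v i) (w i)

  -- for every vertex x there are k mutually avoiding Eulerian circuits at x
  -- (av(G) is the largest such k)
  AvAchievable : ℕ → Set
  AvAchievable k = ∀ (x : Fin n) → ∃[ m ] Σ (Fin k → Fin (suc m) → Fin n) λ C →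
      (∀ i → EulerianCircuit x m (C i)) × (∀ i j → i ≢ j → Avoiding m (C i) (C j))

  deg : Fin n → ℕ
  deg v = length (filterᵇ (adj G v) (allFin n))

  S : Fin n → ℕ
  S v = sum (map deg (filterᵇ (λ u → not (adj G v u) ∧ not (isYes (u ≟ v))) (allFin n)))

  IndepInNbhd : Fin n → Subset n → Set
  IndepInNbhd v p = (∀ u → u ∈ p → Adjacent v u) × (∀ u w → u ∈ p → w ∈ p → ¬ Adjacent u w)

  IsIndepNumberNbhd : Fin n → ℕ → Set
  IsIndepNumberNbhd v a = (∃[ p ] (IndepInNbhd v p × ∣ p ∣ ≡ a))
                        × (∀ p → IndepInNbhd v p → ∣ p ∣ ≤ a)

-- The second vertices of k mutually avoiding Eulerian circuits from v are k distinct, pairwise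
-- non-adjacent neighbours of v, which gives (i) and (ii).  For (iii) and the bound on S, start the
-- circuits C₀, …, C_{k-1} at a vertex x that is neither v nor adjacent to v.  Each Cⱼ with j ≥ 1
-- leaves v along every edge vy at some interior position p, and there C₀ must be at a vertex that is
-- neither v nor adjacent to v.  So C₀ has (k-1)·deg v distinct darts, plus its first and last darts
-- at x, leaving vertices counted in S(v); as C₀ has exactly S(v) such darts, (k-1)·deg v + 2 ≤ S(v).
-- If v is adjacent to every other vertex, the same argument at p gives a contradiction as soon as
-- k ≥ 2, while av ≥ 1 holds because an Eulerian circuit can be rotated to start anywhere.
-- Bounding S(v) by (n - deg v - 1)·Δ yields the last claim.

module Submission where

open import Defs hiding (sym)
open import Data.Bool using (Bool; true; false; not; _∧_)
open import Data.Bool.Properties using (T-≡)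
open import Data.Empty using (⊥-elim)
open import Data.Fin as Fin using (Fin; zero; suc; toℕ; fromℕ; inject₁; splitAt; join; remQuot; combine)
open import Data.Fin.Properties using (injective⇒≤; toℕ-injective; toℕ-fromℕ; toℕ-fromℕ<; toℕ-inject₁; toℕ<n; toℕ≤pred[n]; join-splitAt; combine-remQuot; any?)
open import Data.Fin.Subset using (Subset; ∣_∣) renaming (_∈_ to _∈ₛ_)
open import Data.List as List using (List; []; _∷_; length; filterᵇ; map; allFin; concatMap; _++_)
open import Data.List.Membership.Propositional using (_∈_)
open import Data.List.Membership.Propositional.Properties using (∈-filter⁺; ∈-filter⁻; ∈-allFin; ∈-map⁺; ∈-++⁺ˡ; ∈-++⁺ʳ; ∈-lookup)
open import Data.List.Properties using (length-tabulate; length-++; length-map; filter-all)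
import Data.List.Relation.Unary.All as All
open import Data.List.Relation.Unary.AllPairs using (_∷_)
open import Data.List.Relation.Unary.Any using (here; there; index)
open import Data.List.Relation.Unary.Any.Properties using (lookup-index)
open import Data.List.Relation.Unary.Unique.Propositional using (Unique)
import Data.List.Relation.Unary.Unique.Propositional.Properties as Unique
open import Data.Nat using (ℕ; zero; suc; _+_; _*_; _∸_; _≤_; _<_; z≤n; s≤s; NonZero)
open import Data.Nat.DivMod using (_%_; _mod_; m%n<n; m<n⇒m%n≡m; n%n≡0; %-distribˡ-+; m%n%n≡m%n; [m+n]%n≡m%n)
open import Data.Nat.ListAction using (sum)
open import Data.Nat.Properties
open import Data.Product using (Σ; ∃-syntax; _×_; _,_; proj₁; proj₂; uncurry)
open import Data.Sum using (inj₁; inj₂; [_,_]′)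
open import Data.Vec using (tabulate; lookup) renaming ([] to []ᵥ; _∷_ to _∷ᵥ_)
open import Data.Vec.Properties using (lookup∘tabulate; []=⇒lookup)
open import Function using (_∘_)
open import Function.Bundles using (Equivalence)
open import Function.Consequences.Propositional using (inverseʳ⇒injective; strictlyInverseʳ⇒inverseʳ)
open import Function.Definitions using (Injective; StrictlyInverseʳ)
open import Relation.Binary.PropositionalEquality using (_≡_; _≢_; refl; sym; trans; cong; cong₂; subst; subst₂; module ≡-Reasoning)
open import Relation.Nullary using (¬_; yes; no; ¬?)
open import Relation.Nullary.Decidable using (T?; isYes; _×-dec_; toWitness; fromWitness)

injective⇒≤-length : ∀ {A : Set} {a} (xs : List A) (f : Fin a → A) →
  Injective _≡_ _≡_ f → (∀ i → f i ∈ xs) → a ≤ length xs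
injective⇒≤-length xs f f-inj f∈xs = injective⇒≤ index-injective
  where
  index-injective : Injective _≡_ _≡_ (index ∘ f∈xs)
  index-injective {i} {j} eq = f-inj (begin
    f i                                  ≡⟨ lookup-index (f∈xs i) ⟩
    List.lookup xs (index (f∈xs i))      ≡⟨ cong (List.lookup xs) eq ⟩
    List.lookup xs (index (f∈xs j))      ≡⟨ lookup-index (f∈xs j) ⟨
    f j                                  ∎)
    where open ≡-Reasoning

leftInverse⇒injective : ∀ {A B : Set} (f : A → B) (g : B → A) → StrictlyInverseʳ _≡_ f g → Injective _≡_ _≡_ f
leftInverse⇒injective f g inv = inverseʳ⇒injective {f⁻¹ = g} f (strictlyInverseʳ⇒inverseʳ f inv)

distinct⇒injective : ∀ {A : Set} {k} (f : Fin k → A) → (∀ i j → i ≢ j → f i ≢ f j) → Injective _≡_ _≡_ f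
distinct⇒injective f distinct {i} {j} eq with i Fin.≟ j
... | yes i≡j = i≡j
... | no i≢j = ⊥-elim (distinct i j i≢j eq)

[,]-injective : ∀ {A B C : Set} {f : A → C} {g : B → C} → Injective _≡_ _≡_ f → Injective _≡_ _≡_ g →
                (∀ a b → f a ≢ g b) → Injective _≡_ _≡_ [ f , g ]′
[,]-injective f-inj g-inj disjoint {inj₁ a} {inj₁ a′} eq = cong inj₁ (f-inj eq)
[,]-injective f-inj g-inj disjoint {inj₁ a} {inj₂ b}  eq = ⊥-elim (disjoint a b eq)
[,]-injective f-inj g-inj disjoint {inj₂ b} {inj₁ a}  eq = ⊥-elim (disjoint a b (sym eq))
[,]-injective f-inj g-inj disjoint {inj₂ b} {inj₂ b′} eq = cong inj₂ (g-inj eq)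

lookup-injective : ∀ {A : Set} {xs : List A} → Unique xs → Injective _≡_ _≡_ (List.lookup xs)
lookup-injective (x∉xs ∷ _)  {zero}  {zero}  _  = refl
lookup-injective (x∉xs ∷ _)  {zero}  {suc j} eq = ⊥-elim (All.lookup x∉xs (∈-lookup j) eq)
lookup-injective (x∉xs ∷ _)  {suc i} {zero}  eq = ⊥-elim (All.lookup x∉xs (∈-lookup i) (sym eq))
lookup-injective (_ ∷ uniq) {suc i} {suc j} eq = cong suc (lookup-injective uniq eq)

∈-filterᵇ⁺ : ∀ {A : Set} (p : A → Bool) {xs u} → u ∈ xs → p u ≡ true → u ∈ filterᵇ p xs
∈-filterᵇ⁺ p u∈xs pu = ∈-filter⁺ (T? ∘ p) u∈xs (Equivalence.from T-≡ pu)

∈-filterᵇ⁻ : ∀ {A : Set} (p : A → Bool) {xs u} → u ∈ filterᵇ p xs → p u ≡ true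
∈-filterᵇ⁻ p {xs} u∈ = Equivalence.to T-≡ (proj₂ (∈-filter⁻ (T? ∘ p) {xs = xs} u∈))

sum-map-≤ : ∀ {A : Set} (f : A → ℕ) {c} → (∀ a → f a ≤ c) → ∀ xs → sum (map f xs) ≤ length xs * c
sum-map-≤ f f≤c []       = z≤n
sum-map-≤ f f≤c (x ∷ xs) = +-mono-≤ (f≤c x) (sum-map-≤ f f≤c xs)

length-filterᵇ-∧-split : ∀ {A : Set} (p q : A → Bool) xs →
  length (filterᵇ (λ u → p u ∧ q u) xs) + length (filterᵇ (λ u → p u ∧ not (q u)) xs)
    ≡ length (filterᵇ p xs)
length-filterᵇ-∧-split p q [] = refl
length-filterᵇ-∧-split p q (x ∷ xs) with p x | q x
... | true  | true  = cong suc (length-filterᵇ-∧-split p q xs)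
... | true  | false = trans (+-suc _ _) (cong suc (length-filterᵇ-∧-split p q xs))
... | false | _     = length-filterᵇ-∧-split p q xs

length-filterᵇ-true : ∀ {A : Set} (xs : List A) → length (filterᵇ (λ _ → true) xs) ≡ length xs
length-filterᵇ-true xs = cong length (filter-all (T? ∘ λ _ → true) (All.universal _ xs))

length-filterᵇ-tabulate : ∀ {A : Set} {k} (p : Subset k) (g : Fin k → A) (q : A → Bool) →
                          (∀ i → q (g i) ≡ lookup p i) → length (filterᵇ q (List.tabulate g)) ≡ ∣ p ∣
length-filterᵇ-tabulate []ᵥ       g q q∘g≗p = refl
length-filterᵇ-tabulate (b ∷ᵥ p) g q q∘g≗p with q (g zero) | q∘g≗p zero
... | true  | refl = cong suc (length-filterᵇ-tabulate p (g ∘ suc) q (q∘g≗p ∘ suc))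
... | false | refl = length-filterᵇ-tabulate p (g ∘ suc) q (q∘g≗p ∘ suc)

a<n∸1⇒a+2≤n : ∀ {a n} → a < n ∸ 1 → a + 2 ≤ n
a<n∸1⇒a+2≤n {a} {suc n} a<n = subst (_≤ suc n) (+-comm 2 a) (s≤s a<n)

≢⇒2≤n : ∀ {n} {a b : Fin n} → a ≢ b → 2 ≤ n
≢⇒2≤n {suc zero}    {zero} {zero} a≢b = ⊥-elim (a≢b refl)
≢⇒2≤n {suc (suc _)} _ = s≤s (s≤s z≤n)

module _ {n : ℕ} (G : Graph n) where

  neighbours : Fin n → List (Fin n)
  neighbours v = filterᵇ (adj G v) (allFin n)

  nonNeighbours : Fin n → List (Fin n)
  nonNeighbours v = filterᵇ (not ∘ adj G v) (allFin n)

  Distant : Fin n → Fin n → Set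
  Distant u x = u ≢ x × ¬ Adjacent G u x

  distantᵇ : Fin n → Fin n → Bool
  distantᵇ v u = not (adj G v u) ∧ not (isYes (u Fin.≟ v))

  -- S G v is definitionally the sum of the degrees over this list.
  distantVertices : Fin n → List (Fin n)
  distantVertices v = filterᵇ (distantᵇ v) (allFin n)

  ¬adjacent⇒adj≡false : ∀ {u v} → ¬ Adjacent G u v → adj G u v ≡ false
  ¬adjacent⇒adj≡false {u} {v} ¬uv with adj G u v
  ... | true  = ⊥-elim (¬uv refl)
  ... | false = refl

  adj≡false⇒¬adjacent : ∀ {u v} → adj G u v ≡ false → ¬ Adjacent G u v
  adj≡false⇒¬adjacent uv≡false uv with () ← trans (sym uv) uv≡false

  adjacent⇒≢ : ∀ {a b} → Adjacent G a b → a ≢ b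
  adjacent⇒≢ {a} ab refl with () ← trans (sym ab) (irrefl G a)

  ∈-distantVertices : ∀ {v x} → Distant v x → x ∈ distantVertices v
  ∈-distantVertices {v} {x} (v≢x , ¬vx) = ∈-filterᵇ⁺ (distantᵇ v) (∈-allFin x) distant
    where
    distant : distantᵇ v x ≡ true
    distant rewrite ¬adjacent⇒adj≡false ¬vx with x Fin.≟ v
    ... | yes x≡v = ⊥-elim (v≢x (sym x≡v))
    ... | no _    = refl

  deg+nonNeighbours : ∀ v → deg G v + length (nonNeighbours v) ≡ n
  deg+nonNeighbours v = begin
    deg G v + length (nonNeighbours v)               ≡⟨ length-filterᵇ-∧-split (λ _ → true) (adj G v) (allFin n) ⟩
    length (filterᵇ (λ _ → true) (allFin n))         ≡⟨ length-filterᵇ-true (allFin n) ⟩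
    length (allFin n)                                ≡⟨ length-tabulate (λ i → i) ⟩
    n                                                ∎
    where open ≡-Reasoning

  distantVertices<nonNeighbours : ∀ v → length (distantVertices v) < length (nonNeighbours v)
  distantVertices<nonNeighbours v =
    ≤-trans (m<m+n _ v-itself) (≤-reflexive (length-filterᵇ-∧-split (not ∘ adj G v) (not ∘ isV) (allFin n)))
    where
    isV : Fin n → Bool
    isV u = isYes (u Fin.≟ v)
    v-itself : 0 < length (filterᵇ (λ u → not (adj G v u) ∧ not (not (isV u))) (allFin n))
    v-itself = injective⇒≤-length _ (λ _ → v) (λ { {zero} {zero} _ → refl })
                 (λ _ → ∈-filterᵇ⁺ _ (∈-allFin v) v-kept)
      where
      v-kept : not (adj G v v) ∧ not (not (isV v)) ≡ true
      v-kept rewrite irrefl G v with v Fin.≟ v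
      ... | yes _  = refl
      ... | no v≢v = ⊥-elim (v≢v refl)

  distant⇒deg+2≤n : ∀ {v x} → Distant v x → deg G v + 2 ≤ n
  distant⇒deg+2≤n {v} {x} (v≢x , ¬vx) = begin
    deg G v + 2                         ≤⟨ +-monoʳ-≤ (deg G v) two-nonNeighbours ⟩
    deg G v + length (nonNeighbours v)  ≡⟨ deg+nonNeighbours v ⟩
    n                                   ∎
    where
    open ≤-Reasoning
    pair : Fin 2 → Fin n
    pair zero       = v
    pair (suc zero) = x
    pair-injective : Injective _≡_ _≡_ pair
    pair-injective {zero}     {zero}     _  = refl
    pair-injective {zero}     {suc zero} eq = ⊥-elim (v≢x eq)
    pair-injective {suc zero} {zero}     eq = ⊥-elim (v≢x (sym eq))
    pair-injective {suc zero} {suc zero} _  = refl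
    two-nonNeighbours : 2 ≤ length (nonNeighbours v)
    two-nonNeighbours = injective⇒≤-length _ pair pair-injective λ
      { zero       → ∈-filterᵇ⁺ _ (∈-allFin v) (cong not (irrefl G v))
      ; (suc zero) → ∈-filterᵇ⁺ _ (∈-allFin x) (cong not (¬adjacent⇒adj≡false ¬vx)) }

  deg+2≤n⇒distant : ∀ v → deg G v + 2 ≤ n → ∃[ x ] Distant v x
  deg+2≤n⇒distant v d+2≤n with any? (λ x → ¬? (v Fin.≟ x) ×-dec ¬? (adj G v x Data.Bool.≟ true))
  ... | yes found = found
  ... | no none   = ⊥-elim (≤⇒≯ n≤1+deg (subst (_≤ n) (+-comm (deg G v) 2) d+2≤n))
    where
    covered : ∀ u → u ∈ v ∷ neighbours v
    covered u with u Fin.≟ v | adj G v u in vu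
    ... | yes refl | _     = here refl
    ... | no _     | true  = there (∈-filterᵇ⁺ _ (∈-allFin u) vu)
    ... | no u≢v   | false = ⊥-elim (none (u , u≢v ∘ sym , adj≡false⇒¬adjacent vu))
    n≤1+deg : n ≤ suc (deg G v)
    n≤1+deg = injective⇒≤-length (v ∷ neighbours v) (λ u → u) (λ eq → eq) covered

  deg≡n∸1⇒adjacent : ∀ {u z} → deg G u ≡ n ∸ 1 → z ≢ u → Adjacent G u z
  deg≡n∸1⇒adjacent {u} {z} du z≢u with adj G u z in uz
  ... | true  = refl
  ... | false = ⊥-elim (n∸1+2≰n n (subst (λ d → d + 2 ≤ n) du
                  (distant⇒deg+2≤n (z≢u ∘ sym , adj≡false⇒¬adjacent uz))))
    where
    n∸1+2≰n : ∀ m → ¬ (m ∸ 1 + 2 ≤ m)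
    n∸1+2≰n (suc m) le = 1+n≰n (subst (_≤ suc m) (+-comm m 2) le)

  arcsFrom : List (Fin n) → List (Fin n × Fin n)
  arcsFrom = concatMap (λ u → map (u ,_) (neighbours u))

  length-arcsFrom : ∀ us → length (arcsFrom us) ≡ sum (map (deg G) us)
  length-arcsFrom []       = refl
  length-arcsFrom (u ∷ us) = begin
    length (map (u ,_) (neighbours u) ++ arcsFrom us)
      ≡⟨ length-++ (map (u ,_) (neighbours u)) ⟩
    length (map (u ,_) (neighbours u)) + length (arcsFrom us)
      ≡⟨ cong₂ _+_ (length-map (u ,_) (neighbours u)) (length-arcsFrom us) ⟩
    deg G u + sum (map (deg G) us)
      ∎
    where open ≡-Reasoning

  ∈-arcsFrom : ∀ {us u v} → u ∈ us → Adjacent G u v → (u , v) ∈ arcsFrom us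
  ∈-arcsFrom {u ∷ _}  (here refl) uv = ∈-++⁺ˡ (∈-map⁺ (u ,_) (∈-filterᵇ⁺ _ (∈-allFin _) uv))
  ∈-arcsFrom {u′ ∷ _} (there u∈) uv = ∈-++⁺ʳ (map (u′ ,_) (neighbours u′)) (∈-arcsFrom u∈ uv)

-- The dart (i , false) traverses step i of a walk forwards, (i , true) backwards.
Dart : ℕ → Set
Dart m = Fin m × Bool

tailPos headPos : ∀ {m} → Dart m → Fin (suc m)
tailPos (i , false) = inject₁ i
tailPos (i , true)  = suc i
headPos (i , false) = suc i
headPos (i , true)  = inject₁ i

module EulerianCircuitProperties {n} (G : Graph n) {x : Fin n} {m : ℕ} (w : Fin (suc m) → Fin n)
                                 (ec : EulerianCircuit G x m w) where

  starts : w zero ≡ x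
  starts = proj₁ ec

  ends : w (fromℕ m) ≡ x
  ends = proj₁ (proj₂ ec)

  step-adjacent : ∀ i → Adjacent G (w (inject₁ i)) (w (suc i))
  step-adjacent = proj₁ (proj₂ (proj₂ ec))

  steps-distinct : ∀ i j → SameEdge G (w (inject₁ i)) (w (suc i)) (w (inject₁ j)) (w (suc j)) → i ≡ j
  steps-distinct = proj₁ (proj₂ (proj₂ (proj₂ ec)))

  steps-cover : ∀ u v → Adjacent G u v → ∃[ i ] SameEdge G (w (inject₁ i)) (w (suc i)) u v
  steps-cover = proj₂ (proj₂ (proj₂ (proj₂ ec)))

  step-irreflexive : ∀ i → w (inject₁ i) ≢ w (suc i)
  step-irreflexive i eq = adjacent⇒≢ G (step-adjacent i) eq

  dart-adjacent : ∀ h → Adjacent G (w (tailPos h)) (w (headPos h))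
  dart-adjacent (i , false) = step-adjacent i
  dart-adjacent (i , true)  = trans (Graph.sym G _ _) (step-adjacent i)

  dart-from-to : ∀ {u v} → Adjacent G u v → ∃[ h ] w (tailPos h) ≡ u × w (headPos h) ≡ v
  dart-from-to {u} {v} uv with steps-cover u v uv
  ... | i , inj₁ (tail≡u , head≡v) = (i , false) , tail≡u , head≡v
  ... | i , inj₂ (tail≡v , head≡u) = (i , true)  , head≡u , tail≡v

  dart-injective : ∀ h h′ → w (tailPos h) ≡ w (tailPos h′) → w (headPos h) ≡ w (headPos h′) → h ≡ h′
  dart-injective (i , false) (j , false) tails heads with refl ← steps-distinct i j (inj₁ (tails , heads)) = refl
  dart-injective (i , true)  (j , true)  tails heads with refl ← steps-distinct i j (inj₁ (heads , tails)) = refl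
  dart-injective (i , false) (j , true)  tails heads with refl ← steps-distinct i j (inj₂ (tails , heads)) =
    ⊥-elim (step-irreflexive i tails)
  dart-injective (i , true)  (j , false) tails heads with refl ← steps-distinct i j (inj₂ (heads , tails)) =
    ⊥-elim (step-irreflexive i heads)

  interior : ∀ p → w p ≢ x → 0 < toℕ p × toℕ p < m
  interior zero    w0≢x = ⊥-elim (w0≢x starts)
  interior (suc p) wp≢x = s≤s z≤n , ≤∧≢⇒< (toℕ≤pred[n] (suc p)) p≢m
    where
    p≢m : toℕ (suc p) ≢ m
    p≢m p≡m = wp≢x (trans (cong w (toℕ-injective (trans p≡m (sym (toℕ-fromℕ m))))) ends)

  darts-from≤ : ∀ {a} (us : List (Fin n)) (D : Fin a → Dart m) → Injective _≡_ _≡_ D →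
                (∀ i → w (tailPos (D i)) ∈ us) → a ≤ sum (map (deg G) us)
  darts-from≤ us D D-injective tail∈us =
    subst (_ ≤_) (length-arcsFrom G us) (injective⇒≤-length (arcsFrom G us) (arc ∘ D) arc∘D-injective arc∈)
    where
    arc : Dart m → Fin n × Fin n
    arc h = w (tailPos h) , w (headPos h)
    arc∘D-injective : Injective _≡_ _≡_ (arc ∘ D)
    arc∘D-injective {i} {j} eq = D-injective (dart-injective (D i) (D j) (cong proj₁ eq) (cong proj₂ eq))
    arc∈ : ∀ i → arc (D i) ∈ arcsFrom G us
    arc∈ i = ∈-arcsFrom G (tail∈us i) (dart-adjacent (D i))

2≤length : ∀ {n} (G : Graph n) {x m} (w : Fin (suc m) → Fin n) → EulerianCircuit G x m w → HasEdge G → 2 ≤ m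
2≤length G {m = zero}        w ec (a , b , ab)
  with () ← proj₁ (EulerianCircuitProperties.steps-cover G w ec a b ab)
2≤length G {m = suc zero}    w ec _ = ⊥-elim (step-irreflexive zero (trans starts (sym ends)))
  where open EulerianCircuitProperties G w ec
2≤length G {m = suc (suc m)} _ _  _ = s≤s (s≤s z≤n)

avoiding⇒distant : ∀ {n} (G : Graph n) {x m} (C C′ : Fin (suc m) → Fin n) → EulerianCircuit G x m C →
                   Avoiding G m C C′ → ∀ p → C p ≢ x → Distant G (C p) (C′ p)
avoiding⇒distant G C C′ ec avoid p Cp≢x = uncurry (avoid p) (EulerianCircuitProperties.interior G C ec p Cp≢x)

module _ {n : ℕ} (G : Graph n) where

  IndependentNeighbours : Fin n → ℕ → Set
  IndependentNeighbours v k = Σ (Fin k → Fin n) λ f →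
    (∀ j → Adjacent G v (f j)) × (∀ i j → i ≢ j → Distant G (f i) (f j))

  avoiding⇒independentNeighbours : HasEdge G → ∀ k → AvAchievable G k → ∀ v → IndependentNeighbours v k
  avoiding⇒independentNeighbours _  zero    _  v = (λ ()) , (λ ()) , (λ ())
  avoiding⇒independentNeighbours he (suc k) av v
    with m , C , circuits , avoiding ← av v
    with s≤s (s≤s _) ← 2≤length G (C zero) (circuits zero) he
    = second , second-adjacent , λ i j i≢j → avoiding i j i≢j (suc zero) (s≤s z≤n) (s≤s (s≤s z≤n))
    where
    second : Fin (suc k) → Fin n
    second j = C j (suc zero)
    second-adjacent : ∀ j → Adjacent G v (second j)
    second-adjacent j = subst (λ u → Adjacent G u (second j)) starts (step-adjacent zero)
      where open EulerianCircuitProperties G (C j) (circuits j)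

  independentNeighbours⇒injective : ∀ {v k} ((f , _) : IndependentNeighbours v k) → Injective _≡_ _≡_ f
  independentNeighbours⇒injective (f , _ , independent) =
    distinct⇒injective f (λ i j i≢j → proj₁ (independent i j i≢j))

  independentNeighbours≤deg : ∀ {v k} → IndependentNeighbours v k → k ≤ deg G v
  independentNeighbours≤deg {v} I@(f , adjacent , _) =
    injective⇒≤-length (neighbours G v) f (independentNeighbours⇒injective I)
      (λ j → ∈-filterᵇ⁺ _ (∈-allFin (f j)) (adjacent j))

  image : ∀ {k} → (Fin k → Fin n) → Subset n
  image f = tabulate (λ u → isYes (any? (λ j → f j Fin.≟ u)))

  ∈-image⁻ : ∀ {k} (f : Fin k → Fin n) {u} → u ∈ₛ image f → ∃[ j ] f j ≡ u
  ∈-image⁻ f {u} u∈ = toWitness (Equivalence.from T-≡ (trans (sym (lookup∘tabulate _ u)) ([]=⇒lookup u∈)))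

  lookup-image : ∀ {k} (f : Fin k → Fin n) j → lookup (image f) (f j) ≡ true
  lookup-image f j = trans (lookup∘tabulate _ (f j)) (Equivalence.to T-≡ (fromWitness (j , refl)))

  injective⇒≤∣image∣ : ∀ {k} (f : Fin k → Fin n) → Injective _≡_ _≡_ f → k ≤ ∣ image f ∣
  injective⇒≤∣image∣ f f-injective =
    subst (_ ≤_) (length-filterᵇ-tabulate (image f) (λ u → u) (lookup (image f)) (λ _ → refl))
      (injective⇒≤-length (filterᵇ (lookup (image f)) (allFin n)) f f-injective
        (λ j → ∈-filterᵇ⁺ (lookup (image f)) (∈-allFin (f j)) (lookup-image f j)))

  independentNeighbours⇒indepInNbhd : ∀ {v k} ((f , _) : IndependentNeighbours v k) → IndepInNbhd G v (image f)
  independentNeighbours⇒indepInNbhd (f , adjacent , independent) = in-nbhd , no-edges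
    where
    in-nbhd : ∀ u → u ∈ₛ image f → Adjacent G _ u
    in-nbhd u u∈ with j , refl ← ∈-image⁻ f u∈ = adjacent j
    no-edges : ∀ u u′ → u ∈ₛ image f → u′ ∈ₛ image f → ¬ Adjacent G u u′
    no-edges u u′ u∈ u′∈ with j , refl ← ∈-image⁻ f u∈ | j′ , refl ← ∈-image⁻ f u′∈ | j Fin.≟ j′
    ... | yes refl = adj≡false⇒¬adjacent G (irrefl G (f j))
    ... | no j≢j′  = proj₂ (independent j j′ j≢j′)

  k≤deg : HasEdge G → ∀ k → AvAchievable G k → ∀ v → k ≤ deg G v
  k≤deg he k av v = independentNeighbours≤deg (avoiding⇒independentNeighbours he k av v)

  k≤α : HasEdge G → ∀ k → AvAchievable G k → ∀ v a → IsIndepNumberNbhd G v a → k ≤ a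
  k≤α he k av v a (_ , maximal) =
    ≤-trans (injective⇒≤∣image∣ f (independentNeighbours⇒injective I))
            (maximal (image f) (independentNeighbours⇒indepInNbhd I))
    where
    I : IndependentNeighbours v k
    I = avoiding⇒independentNeighbours he k av v
    f : Fin k → Fin n
    f = proj₁ I

sameEdge-cong : ∀ {n} (G : Graph n) {a b c d a′ b′ c′ d′} → a ≡ a′ → b ≡ b′ → c ≡ c′ → d ≡ d′ →
                SameEdge G a b c d → SameEdge G a′ b′ c′ d′
sameEdge-cong G refl refl refl refl same = same

reindex-eulerianCircuit : ∀ {n} (G : Graph n) {x y m} (w w′ : Fin (suc m) → Fin n) (σ τ : Fin m → Fin m) →
  (∀ i → σ (τ i) ≡ i) → (∀ i → τ (σ i) ≡ i) →
  (∀ i → w′ (inject₁ i) ≡ w (inject₁ (σ i))) → (∀ i → w′ (suc i) ≡ w (suc (σ i))) →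
  w′ zero ≡ y → w′ (fromℕ m) ≡ y → EulerianCircuit G x m w → EulerianCircuit G y m w′
reindex-eulerianCircuit G w w′ σ τ στ τσ tails heads start end ec =
    start
  , end
  , (λ i → subst₂ (Adjacent G) (sym (tails i)) (sym (heads i)) (step-adjacent (σ i)))
  , (λ i j same → begin
       i          ≡⟨ τσ i ⟨
       τ (σ i)    ≡⟨ cong τ (steps-distinct (σ i) (σ j)
                             (sameEdge-cong G (tails i) (heads i) (tails j) (heads j) same)) ⟩
       τ (σ j)    ≡⟨ τσ j ⟩
       j          ∎)
  , λ u v uv → let (i , same) = steps-cover u v uv in
      τ i , sameEdge-cong G (sym (trans (tails (τ i)) (cong (w ∘ inject₁) (στ i))))
                            (sym (trans (heads (τ i)) (cong (w ∘ suc) (στ i)))) refl refl same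
  where
  open EulerianCircuitProperties G w ec
  open ≡-Reasoning

module Residues (M : ℕ) .{{_ : NonZero M}} where

  toℕ-mod : ∀ a → toℕ (a mod M) ≡ a % M
  toℕ-mod a = toℕ-fromℕ< (m%n<n a M)

  mod-cong : ∀ a b → a % M ≡ b % M → a mod M ≡ b mod M
  mod-cong a b eq = toℕ-injective (trans (toℕ-mod a) (trans eq (sym (toℕ-mod b))))

  toℕ-mod-toℕ : ∀ i → toℕ i mod M ≡ i
  toℕ-mod-toℕ i = toℕ-injective (trans (toℕ-mod (toℕ i)) (m<n⇒m%n≡m (toℕ<n i)))

  toℕ-mod-+ : ∀ a b → (toℕ (a mod M) + b) mod M ≡ (a + b) mod M
  toℕ-mod-+ a b = mod-cong _ _ (begin
    (toℕ (a mod M) + b) % M      ≡⟨ cong (λ t → (t + b) % M) (toℕ-mod a) ⟩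
    (a % M + b) % M              ≡⟨ %-distribˡ-+ (a % M) b M ⟩
    (a % M % M + b % M) % M      ≡⟨ cong (λ t → (t + b % M) % M) (m%n%n≡m%n a M) ⟩
    (a % M + b % M) % M          ≡⟨ %-distribˡ-+ a b M ⟨
    (a + b) % M                  ∎)
    where open ≡-Reasoning

  +M-mod : ∀ a → (a + M) mod M ≡ a mod M
  +M-mod a = mod-cong _ _ ([m+n]%n≡m%n a M)

  shift : ℕ → Fin M → Fin M
  shift a i = (toℕ i + a) mod M

  shift-inverse : ∀ a b → a + b ≡ M → ∀ i → shift b (shift a i) ≡ i
  shift-inverse a b a+b≡M i = begin
    (toℕ ((toℕ i + a) mod M) + b) mod M   ≡⟨ toℕ-mod-+ (toℕ i + a) b ⟩
    (toℕ i + a + b) mod M                 ≡⟨ cong (_mod M) (trans (+-assoc (toℕ i) a b) (cong (toℕ i +_) a+b≡M)) ⟩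
    (toℕ i + M) mod M                     ≡⟨ +M-mod (toℕ i) ⟩
    toℕ i mod M                           ≡⟨ toℕ-mod-toℕ i ⟩
    i                                     ∎
    where open ≡-Reasoning

module Rotation {n} (G : Graph n) {x₀ : Fin n} {m : ℕ} (w : Fin (suc (suc m)) → Fin n)
                (ec : EulerianCircuit G x₀ (suc m) w) where

  open Residues (suc m)
  open EulerianCircuitProperties G w ec using (starts; ends)

  vertexAt : Fin (suc m) → Fin n
  vertexAt i = w (inject₁ i)

  w≡vertexAt-mod : ∀ p → w p ≡ vertexAt (toℕ p mod suc m)
  w≡vertexAt-mod p with toℕ p Data.Nat.≟ suc m
  ... | no p≢len = cong w (toℕ-injective (sym (begin
    toℕ (inject₁ (toℕ p mod suc m))   ≡⟨ toℕ-inject₁ _ ⟩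
    toℕ (toℕ p mod suc m)             ≡⟨ toℕ-mod (toℕ p) ⟩
    toℕ p % suc m                     ≡⟨ m<n⇒m%n≡m (≤∧≢⇒< (toℕ≤pred[n] p) p≢len) ⟩
    toℕ p                             ∎)))
    where open ≡-Reasoning
  ... | yes p≡len = begin
    w p                               ≡⟨ cong w (toℕ-injective (trans p≡len (sym (toℕ-fromℕ (suc m))))) ⟩
    w (fromℕ (suc m))                 ≡⟨ trans ends (sym starts) ⟩
    w zero                            ≡⟨ cong vertexAt (mod-cong (toℕ p) 0 p%len≡0) ⟨
    vertexAt (toℕ p mod suc m)        ∎
    where
    open ≡-Reasoning
    p%len≡0 : toℕ p % suc m ≡ 0
    p%len≡0 = trans (cong (_% suc m) p≡len) (n%n≡0 (suc m))

  rotate : Fin (suc m) → Fin (suc (suc m)) → Fin n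
  rotate ρ j = vertexAt ((toℕ j + toℕ ρ) mod suc m)

  rotate-eulerianCircuit : ∀ ρ → EulerianCircuit G (vertexAt ρ) (suc m) (rotate ρ)
  rotate-eulerianCircuit ρ =
    reindex-eulerianCircuit G w (rotate ρ) (shift (toℕ ρ)) (shift (suc m ∸ toℕ ρ))
      (shift-inverse _ _ (m∸n+n≡m ρ≤len)) (shift-inverse _ _ (m+[n∸m]≡n ρ≤len))
      (λ i → cong (λ t → vertexAt ((t + toℕ ρ) mod suc m)) (toℕ-inject₁ i))
      rotate-suc
      (cong vertexAt (toℕ-mod-toℕ ρ))
      (cong vertexAt (begin
        (toℕ (fromℕ (suc m)) + toℕ ρ) mod suc m   ≡⟨ cong (λ t → (t + toℕ ρ) mod suc m) (toℕ-fromℕ (suc m)) ⟩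
        (suc m + toℕ ρ) mod suc m                 ≡⟨ cong (_mod suc m) (+-comm (suc m) (toℕ ρ)) ⟩
        (toℕ ρ + suc m) mod suc m                 ≡⟨ +M-mod (toℕ ρ) ⟩
        toℕ ρ mod suc m                           ≡⟨ toℕ-mod-toℕ ρ ⟩
        ρ                                         ∎))
      ec
    where
    open ≡-Reasoning
    ρ≤len : toℕ ρ ≤ suc m
    ρ≤len = <⇒≤ (toℕ<n ρ)
    rotate-suc : ∀ i → rotate ρ (suc i) ≡ w (suc (shift (toℕ ρ) i))
    rotate-suc i = sym (begin
      w (suc (shift (toℕ ρ) i))                          ≡⟨ w≡vertexAt-mod (suc (shift (toℕ ρ) i)) ⟩
      vertexAt (suc (toℕ (shift (toℕ ρ) i)) mod suc m)   ≡⟨ cong (λ t → vertexAt (t mod suc m)) (+-comm 1 _) ⟩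
      vertexAt ((toℕ (shift (toℕ ρ) i) + 1) mod suc m)   ≡⟨ cong vertexAt (toℕ-mod-+ (toℕ i + toℕ ρ) 1) ⟩
      vertexAt ((toℕ i + toℕ ρ + 1) mod suc m)           ≡⟨ cong (λ t → vertexAt (t mod suc m)) (+-comm _ 1) ⟩
      rotate ρ (suc i)                                   ∎)

  eulerianCircuit-through : ∀ p → Σ (Fin (suc (suc m)) → Fin n) (EulerianCircuit G (w p) (suc m))
  eulerianCircuit-through p =
    rotate ρ , subst (λ y → EulerianCircuit G y (suc m) (rotate ρ)) (sym (w≡vertexAt-mod p))
                 (rotate-eulerianCircuit ρ)
    where
    ρ : Fin (suc m)
    ρ = toℕ p mod suc m

module _ {n : ℕ} (G : Graph n) where

  neighbour-exists : Connected G → HasEdge G → ∀ x → ∃[ z ] Adjacent G x z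
  neighbour-exists connected (a , b , ab) x with x Fin.≟ a | connected x a
  ... | yes refl | _          = b , ab
  ... | no x≢a   | here       = ⊥-elim (x≢a refl)
  ... | no _     | step xz _  = _ , xz

  eulerianCircuit-at : Eulerian G → HasEdge G → ∀ x → ∃[ m ] Σ (Fin (suc m) → Fin n) (EulerianCircuit G x m)
  eulerianCircuit-at (connected , _ , _ , w , ec) he x
    with s≤s _ ← 2≤length G w ec he
    with _ , xz ← neighbour-exists connected he x
    with h , tail≡x , _ ← EulerianCircuitProperties.dart-from-to G w ec xz
    = _ , subst (λ y → Σ _ (EulerianCircuit G y _)) tail≡x
            (Rotation.eulerianCircuit-through G w ec (tailPos h))

  avAchievable-1 : Eulerian G → HasEdge G → AvAchievable G 1
  avAchievable-1 eulerian he x with m , w , ec ← eulerianCircuit-at eulerian he x =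
    m , (λ _ → w) , (λ _ → ec) , λ { zero zero 0≢0 → ⊥-elim (0≢0 refl) }

  other-vertex : HasEdge G → ∀ u → ∃[ x ] x ≢ u
  other-vertex (a , b , ab) u with a Fin.≟ u
  ... | yes refl = b , adjacent⇒≢ G ab ∘ sym
  ... | no a≢u   = a , a≢u

  deg≡n∸1⇒k≤1 : HasEdge G → ∀ {u} → deg G u ≡ n ∸ 1 → ∀ k → AvAchievable G k → k ≤ 1
  deg≡n∸1⇒k≤1 _  _  zero          _  = z≤n
  deg≡n∸1⇒k≤1 _  _  (suc zero)    _  = ≤-refl
  deg≡n∸1⇒k≤1 he {u} du (suc (suc k)) av
    with x , x≢u ← other-vertex he u
    with _ , C , circuits , avoiding ← av x
    with h , tail≡u , _ ← EulerianCircuitProperties.dart-from-to G (C zero) (circuits zero)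
                             (deg≡n∸1⇒adjacent G du x≢u)
    with C₀p≢C₁p , ¬C₀p~C₁p ← avoiding⇒distant G (C zero) (C (suc zero)) (circuits zero)
                                 (avoiding zero (suc zero) (λ ()))
                                 (tailPos h) (λ tail≡x → x≢u (trans (sym tail≡x) tail≡u))
    = ⊥-elim (¬C₀p~C₁p (subst (λ y → Adjacent G y _) (sym tail≡u)
                  (deg≡n∸1⇒adjacent G du (λ C₁p≡u → C₀p≢C₁p (trans tail≡u (sym C₁p≡u))))))

module AvoidanceBound {n} (G : Graph n) {v x : Fin n} (x-distant : Distant G v x)
  {k m : ℕ} (C : Fin (suc k) → Fin (suc (suc m)) → Fin n)
  (circuits : ∀ i → EulerianCircuit G x (suc m) (C i))
  (avoiding : ∀ i j → i ≢ j → Avoiding G (suc m) (C i) (C j)) where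

  open module Circuit i = EulerianCircuitProperties G (C i) (circuits i)

  neighbourAt : Fin (deg G v) → Fin n
  neighbourAt = List.lookup (neighbours G v)

  adjacent-neighbourAt : ∀ t → Adjacent G v (neighbourAt t)
  adjacent-neighbourAt t = ∈-filterᵇ⁻ (adj G v) {allFin n} (∈-lookup t)

  leave : Fin k → Fin (deg G v) → Dart (suc m)
  leave j t = proj₁ (dart-from-to (suc j) (adjacent-neighbourAt t))

  leave-tail : ∀ j t → C (suc j) (tailPos (leave j t)) ≡ v
  leave-tail j t = proj₁ (proj₂ (dart-from-to (suc j) (adjacent-neighbourAt t)))

  leave-head : ∀ j t → C (suc j) (headPos (leave j t)) ≡ neighbourAt t
  leave-head j t = proj₂ (proj₂ (dart-from-to (suc j) (adjacent-neighbourAt t)))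

  endDart : Fin 2 → Dart (suc m)
  endDart zero       = zero , false
  endDart (suc zero) = fromℕ m , true

  endDart-tail : ∀ i e → C i (tailPos (endDart e)) ≡ x
  endDart-tail i zero       = starts i
  endDart-tail i (suc zero) = ends i

  v≢x : v ≢ x
  v≢x = proj₁ x-distant

  leave-tail-distant : ∀ i j t → i ≢ suc j → Distant G v (C i (tailPos (leave j t)))
  leave-tail-distant i j t i≢j =
    subst (λ y → Distant G y (C i (tailPos (leave j t)))) (leave-tail j t)
      (avoiding⇒distant G (C (suc j)) (C i) (circuits (suc j)) (avoiding (suc j) i (i≢j ∘ sym)) _
        (λ tail≡x → v≢x (trans (sym (leave-tail j t)) tail≡x)))

  leave-injective : Injective _≡_ _≡_ (uncurry leave)
  leave-injective {j , t} {j′ , t′} eq with j Fin.≟ j′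
  ... | yes refl = cong (j ,_) (lookup-injective {xs = neighbours G v} neighbours-unique (begin
    neighbourAt t                          ≡⟨ leave-head j t ⟨
    C (suc j) (headPos (leave j t))        ≡⟨ cong (C (suc j) ∘ headPos) eq ⟩
    C (suc j) (headPos (leave j t′))       ≡⟨ leave-head j t′ ⟩
    neighbourAt t′                         ∎))
    where
    open ≡-Reasoning
    neighbours-unique : Unique (neighbours G v)
    neighbours-unique = Unique.filter⁺ (T? ∘ adj G v) (Unique.allFin⁺ n)
  ... | no j≢j′ = ⊥-elim (proj₁ (leave-tail-distant (suc j′) j t (j≢j′ ∘ sym ∘ Data.Fin.Properties.suc-injective))
                    (sym (trans (cong (C (suc j′) ∘ tailPos) eq) (leave-tail j′ t′))))

  endDart-injective : Injective _≡_ _≡_ endDart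
  endDart-injective {zero}     {zero}     _ = refl
  endDart-injective {suc zero} {suc zero} _ = refl
  endDart-injective {zero}     {suc zero} ()
  endDart-injective {suc zero} {zero}     ()

  leave≢endDart : ∀ s e → uncurry leave s ≢ endDart e
  leave≢endDart (j , t) e eq = v≢x (begin
    v                                  ≡⟨ leave-tail j t ⟨
    C (suc j) (tailPos (leave j t))    ≡⟨ cong (C (suc j) ∘ tailPos) eq ⟩
    C (suc j) (tailPos (endDart e))    ≡⟨ endDart-tail (suc j) e ⟩
    x                                  ∎)
    where open ≡-Reasoning

  darts : Fin (k * deg G v + 2) → Dart (suc m)
  darts = [ uncurry leave ∘ remQuot (deg G v) , endDart ]′ ∘ splitAt (k * deg G v)

  darts-injective : Injective _≡_ _≡_ darts
  darts-injective =
    leftInverse⇒injective (splitAt (k * deg G v)) (join (k * deg G v) 2) (join-splitAt (k * deg G v) 2)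
    ∘ [,]-injective (remQuot-injective ∘ leave-injective) endDart-injective
                    (λ q e → leave≢endDart (remQuot {k} (deg G v) q) e)
    where
    remQuot-injective : Injective _≡_ _≡_ (remQuot {k} (deg G v))
    remQuot-injective = leftInverse⇒injective (remQuot {k} (deg G v)) (uncurry combine) (combine-remQuot {k} (deg G v))

  darts-tail-distant : ∀ i → C zero (tailPos (darts i)) ∈ distantVertices G v
  darts-tail-distant i with splitAt (k * deg G v) i
  ... | inj₁ q = ∈-distantVertices G (leave-tail-distant zero j t (λ ()))
    where
    j : Fin k
    j = proj₁ (remQuot {k} (deg G v) q)
    t : Fin (deg G v)
    t = proj₂ (remQuot {k} (deg G v) q)
  ... | inj₂ e = subst (λ y → y ∈ distantVertices G v) (sym (endDart-tail zero e)) (∈-distantVertices G x-distant)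

  bound : k * deg G v + 2 ≤ S G v
  bound = darts-from≤ zero (distantVertices G v) darts darts-injective darts-tail-distant

module _ {n : ℕ} (G : Graph n) where

  k*deg+2≤S : HasEdge G → ∀ k → AvAchievable G (suc k) → ∀ v → deg G v + 2 ≤ n → k * deg G v + 2 ≤ S G v
  k*deg+2≤S he k av v d+2≤n
    with x , x-distant ← deg+2≤n⇒distant G v d+2≤n
    with _ , C , circuits , avoiding ← av x
    with s≤s _ ← 2≤length G (C zero) (circuits zero) he
    = AvoidanceBound.bound G x-distant C circuits avoiding

  k*deg+2≤S+deg : Eulerian G → HasEdge G → ∀ k → AvAchievable G k → ∀ v → deg G v + 2 ≤ n →
                  k * deg G v + 2 ≤ S G v + deg G v
  k*deg+2≤S+deg eulerian he zero    _  v d+2≤n =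
    ≤-trans (k*deg+2≤S he 0 (avAchievable-1 G eulerian he) v d+2≤n) (m≤m+n _ _)
  k*deg+2≤S+deg eulerian he (suc k) av v d+2≤n = begin
    deg G v + k * deg G v + 2      ≡⟨ +-assoc (deg G v) _ 2 ⟩
    deg G v + (k * deg G v + 2)    ≤⟨ +-monoʳ-≤ (deg G v) (k*deg+2≤S he k av v d+2≤n) ⟩
    deg G v + S G v                ≡⟨ +-comm (deg G v) (S G v) ⟩
    S G v + deg G v                ∎
    where open ≤-Reasoning

  k≤n∸Δ∸1 : Eulerian G → HasEdge G → ∀ k → AvAchievable G k → ∀ v → (∀ u → deg G u ≤ deg G v) →
            deg G v ≤ n ∸ 2 → k ≤ n ∸ deg G v ∸ 1
  k≤n∸Δ∸1 eulerian he@(_ , _ , ab) k av v maximal Δ≤n∸2 = ≤-trans k≤b b≤n∸Δ∸1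
    where
    Δ b : ℕ
    Δ = deg G v
    b = length (distantVertices G v)
    k*Δ+2≤[1+b]*Δ : k * Δ + 2 ≤ suc b * Δ
    k*Δ+2≤[1+b]*Δ = begin
      k * Δ + 2        ≤⟨ k*deg+2≤S+deg eulerian he k av v (m≤o∸n⇒m+n≤o Δ (≢⇒2≤n (adjacent⇒≢ G ab)) Δ≤n∸2) ⟩
      S G v + Δ        ≤⟨ +-monoˡ-≤ Δ (sum-map-≤ (deg G) maximal (distantVertices G v)) ⟩
      b * Δ + Δ        ≡⟨ +-comm (b * Δ) Δ ⟩
      suc b * Δ        ∎
      where open ≤-Reasoning
    k≤b : k ≤ b
    k≤b with k ≤? b
    ... | yes k≤b = k≤b
    ... | no k≰b  = ⊥-elim (m+1+n≰m (suc b * Δ)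
                      (≤-trans (+-monoˡ-≤ 2 (*-monoˡ-≤ Δ (≰⇒> k≰b))) k*Δ+2≤[1+b]*Δ))
    b≤n∸Δ∸1 : b ≤ n ∸ Δ ∸ 1
    b≤n∸Δ∸1 = m+n≤o⇒m≤o∸n b (subst₂ _≤_ (+-comm 1 b) nonNeighbours≡n∸Δ (distantVertices<nonNeighbours G v))
      where
      nonNeighbours≡n∸Δ : length (nonNeighbours G v) ≡ n ∸ Δ
      nonNeighbours≡n∸Δ = trans (sym (m+n∸m≡n Δ _)) (cong (_∸ Δ) (deg+nonNeighbours G v))

lemma6 : ∀ {n : ℕ} (G : Graph n) → Eulerian G → HasEdge G →
    ((k : ℕ) → AvAchievable G k → ∀ v → k ≤ deg G v)
    × ((k : ℕ) → AvAchievable G k → ∀ v a → IsIndepNumberNbhd G v a → k ≤ a)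
    × ((∃[ v ] deg G v ≡ n ∸ 1) → AvAchievable G 1 × ((k : ℕ) → AvAchievable G k → k ≤ 1))
    × ((∀ v → deg G v < n ∸ 1) → (k : ℕ) → AvAchievable G k → ∀ v → k * deg G v + 2 ≤ S G v + deg G v)
    × ((k : ℕ) → AvAchievable G k → ∀ v → (∀ u → deg G u ≤ deg G v) → deg G v ≤ n ∸ 2 → k ≤ n ∸ deg G v ∸ 1)
lemma6 G eulerian he =
    k≤deg G he
  , k≤α G he
  , (λ (_ , deg≡n∸1) → avAchievable-1 G eulerian he , deg≡n∸1⇒k≤1 G he deg≡n∸1)
  , (λ deg<n∸1 k av v → k*deg+2≤S+deg G eulerian he k av v (a<n∸1⇒a+2≤n (deg<n∸1 v)))
  , k≤n∸Δ∸1 G eulerian he
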